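{- For all integers $n\geq 1$, $\overline{C}_{6,2}(n)\equiv 1\pmod 2$ if $n$ is a (generalized) pentagonal number, i.e. $n=k(3k-1)/2$ for some $k\in\mathbb{Z}$, and $\overline{C}_{6,2}(n)\equiv 0\pmod 2$ otherwise.
   Context: An overpartition of $n$ is a partition of $n$ in which the first occurrence of each distinct part may optionally be overlined. $\overline{C}_{6,2}(n)$ denotes the number of overpartitions of $n$ in which no part is divisible by $6$ and only parts congruent to $\pm 2 \pmod{6}$ may be overlined; equivalently $\sum_{n\ge0}\overline{C}_{6,2}(n)q^n=\frac{(q^6;q^6)_\infty(-q^2;q^6)_\infty(-q^4;q^6)_\infty}{(q;q)_\infty}$, where $(A;q)_\infty=\prod_{j\ge0}(1-Aq^j)$. -}

module Defs where

open import Data.Nat using (ℕ; zero; suc; _+_; _*_; _∸_; _%_; _≡ᵇ_; _<ᵇ_)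
open import Data.Bool using (Bool; true; false; _∧_; _∨_; not; if_then_else_)
open import Data.List using (List; []; _∷_; length; filter; map; concatMap; upTo)
open import Data.Product using (_×_; _,_; ∃-syntax)
open import Data.Integer as ℤ using (ℤ; +_)
open import Relation.Binary.PropositionalEquality using (_≡_)
open import Relation.Nullary.Decidable using (Dec)
open import Data.Bool.Properties using (_≟_)

-- A candidate overpartition: a list of (part, overlined?) pairs.
Part : Set
Part = ℕ × Bool

-- cands fuel n : all lists of pairs (k , b) with k ≥ 1 whose parts sum to n
-- (valid when fuel ≥ n; each list appears exactly once).
cands : ℕ → ℕ → List (List Part)
cands _ zero = [] ∷ []
cands zero (suc _) = []
cands (suc fuel) (suc n) =
  concatMap (λ i → let k = suc i in
    concatMap (λ b → map ((k , b) ∷_) (cands fuel (suc n ∸ k))) (true ∷ false ∷ []))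
    (upTo (suc n))

-- Ordering condition making the list a canonical overpartition:
-- parts non-increasing; among equal parts the (unique) overlined copy comes
-- first; an overlined part occurs at most once (only the first occurrence of
-- a distinct part may be overlined).
consecOK : Part → Part → Bool
consecOK (a , _) (c , bc) = (c <ᵇ a) ∨ ((a ≡ᵇ c) ∧ not bc)

sortedOK : List Part → Bool
sortedOK [] = true
sortedOK (_ ∷ []) = true
sortedOK (x ∷ y ∷ xs) = consecOK x y ∧ sortedOK (y ∷ xs)

-- Restrictions of C̄_{6,2}: no part divisible by 6; only parts ≡ ±2 (mod 6)
-- may be overlined.
partOK : Part → Bool
partOK (k , b) = not (k % 6 ≡ᵇ 0) ∧ (not b ∨ (k % 6 ≡ᵇ 2) ∨ (k % 6 ≡ᵇ 4))

allPartsOK : List Part → Bool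
allPartsOK [] = true
allPartsOK (x ∷ xs) = partOK x ∧ allPartsOK xs

isC62 : List Part → Bool
isC62 l = sortedOK l ∧ allPartsOK l

C62bar : ℕ → ℕ
C62bar n = length (filter (λ l → isC62 l ≟ true) (cands n n))

Pentagonal : ℕ → Set
Pentagonal n = ∃[ k ] ((+ 2) ℤ.* (+ n) ≡ k ℤ.* ((+ 3) ℤ.* k ℤ.- (+ 1)))

module Submission where

-- Modulo 2 the generating function of C̄₆,₂ is
--   (q⁶;q⁶)(-q²;q⁶)(-q⁴;q⁶)/(q;q) ≡ (q²;q²)/(q;q) = 1/(q;q²) ≡ ∏_{i≥1}(1+qⁱ),
-- whose coefficients mod 2 are given by Euler's pentagonal theorem.  We work
-- with power series over 𝔽₂ (functions ℕ → Bool), in which multiplication by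
-- 1 + qᵉ is an explicit operation, and establish in turn:
--  1. Euler's theorem mod 2, truncated: ∏_{i≤m}(1+qⁱ) agrees with the
--     pentagonal series up to degree m (Shanks' finite identity, proved by
--     induction on m);
--  2. ∏_{i≤m}(1+qⁱ)·∏_{i≤m odd}(1+qⁱ) ≡ 1 modulo q^{m+1}, because the
--     product telescopes to ∏_{m/2<i≤m}(1+q²ⁱ);
--  3. counting the enumeration of Defs mod 2 by largest part, the two
--     overline choices of a part ≡ ±2 (mod 6) cancel; this gives
--     ∏_{i≤m odd}(1+qⁱ)·oddPartsUpTo m = 1 for a series oddPartsUpTo whose
--     coefficient of qⁿ (for m = n) is C̄₆,₂(n) mod 2;
--  4. 1 + qᵉ (e ≥ 1) is cancellable modulo q^{N+1}, so by 2 and 3 the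
--     coefficient of qⁿ in ∏_{i≤n}(1+qⁱ) is C̄₆,₂(n) mod 2.
-- The theorem follows from 1 and 4 once j(3j∓1)/2 is matched with the
-- integer form k(3k-1)/2, k ∈ ℤ, of the statement.

open import Defs
open import Data.Nat using (ℕ; _≥_; _%_)
open import Data.Product using (_×_)
open import Relation.Nullary using (¬_)
open import Relation.Binary.PropositionalEquality using (_≡_)

open import Data.Nat using (zero; suc; _+_; _*_; _∸_; _≤_; _<_; z≤n; s≤s; _≡ᵇ_; _<ᵇ_)
import Data.Nat.Properties as ℕₚ
open import Data.Bool using (Bool; true; false; _∧_; _∨_; not; _xor_; if_then_else_)
import Data.Bool.Properties as Boolₚ
open import Data.Product using (_,_; proj₁; proj₂; ∃-syntax)
open import Data.Sum using (_⊎_; inj₁; inj₂)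
open import Data.Empty using (⊥-elim)
open import Data.Integer as ℤ using (+_)
import Data.Integer.Properties as ℤₚ
open import Data.Maybe using (just; nothing)
open import Function using (_∘_)
open import Data.Nat.Induction using (<-rec)
import Data.Nat.DivMod as DivModₚ
open import Data.List using (List; []; _∷_; _++_; map; concatMap; applyUpTo; filter; length)
open import Level using (0ℓ)
open import Relation.Binary.PropositionalEquality using (refl; sym; trans; cong; cong₂; subst)
open import Relation.Binary.PropositionalEquality.Properties using (module ≡-Reasoning)
import Tactic.RingSolver.Core.AlmostCommutativeRing as ACR
open import Tactic.RingSolver using (solve-∀)
open import Data.Nat.Tactic.RingSolver using () renaming (solve-∀ to solve-ℕ)
open import Data.Integer.Tactic.RingSolver using () renaming (solve-∀ to solve-ℤ)
open ≡-Reasoning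

𝔽₂ : ACR.AlmostCommutativeRing 0ℓ 0ℓ
𝔽₂ = ACR.fromCommutativeRing Boolₚ.xor-∧-commutativeRing
  λ { false → just refl ; true → nothing }

Series : Set
Series = ℕ → Bool

infix 4 _≈_
_≈_ : Series → Series → Set
f ≈ g = ∀ x → f x ≡ g x

≈-refl : ∀ {f} → f ≈ f
≈-refl x = refl

≈-sym : ∀ {f g} → f ≈ g → g ≈ f
≈-sym p x = sym (p x)

≈-trans : ∀ {f g h} → f ≈ g → g ≈ h → f ≈ h
≈-trans p q x = trans (p x) (q x)

infixl 6 _⊕_
_⊕_ : Series → Series → Series
(f ⊕ g) x = f x xor g x

⊕-cong : ∀ {f f′ g g′} → f ≈ f′ → g ≈ g′ → f ⊕ g ≈ f′ ⊕ g′
⊕-cong p q x = cong₂ _xor_ (p x) (q x)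

one : Series
one zero = true
one (suc _) = false

shift : ℕ → Series → Series
shift zero f x = f x
shift (suc e) f zero = false
shift (suc e) f (suc x) = shift e f x

shift-cong : ∀ e {f g} → f ≈ g → shift e f ≈ shift e g
shift-cong zero p x = p x
shift-cong (suc e) p zero = refl
shift-cong (suc e) p (suc x) = shift-cong e p x

shift-⊕ : ∀ e f g → shift e (f ⊕ g) ≈ shift e f ⊕ shift e g
shift-⊕ zero f g x = refl
shift-⊕ (suc e) f g zero = refl
shift-⊕ (suc e) f g (suc x) = shift-⊕ e f g x

shift-+ : ∀ a b f → shift (a + b) f ≈ shift a (shift b f)
shift-+ zero b f x = refl
shift-+ (suc a) b f zero = refl
shift-+ (suc a) b f (suc x) = shift-+ a b f x

shift-≡ : ∀ {a b} f → a ≡ b → shift a f ≈ shift b f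
shift-≡ f refl = ≈-refl

shift-shift : ∀ a b c d f → a + b ≡ c + d → shift a (shift b f) ≈ shift c (shift d f)
shift-shift a b c d f eq =
  ≈-trans (≈-sym (shift-+ a b f)) (≈-trans (shift-≡ f eq) (shift-+ c d f))

shift-below : ∀ e f x → x < e → shift e f x ≡ false
shift-below (suc e) f zero _ = refl
shift-below (suc e) f (suc x) (s≤s x<e) = shift-below e f x x<e

shift-local : ∀ e {f g} x → (∀ y → y + e ≤ x → f y ≡ g y) → shift e f x ≡ shift e g x
shift-local zero x h = h x (ℕₚ.≤-reflexive (ℕₚ.+-identityʳ x))
shift-local (suc e) zero h = refl
shift-local (suc e) (suc x) h =
  shift-local e x (λ y le → h y (subst (_≤ suc x) (sym (ℕₚ.+-suc y e)) (s≤s le)))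

shift-coeff : ∀ e f x → shift e f x ≡ (e <ᵇ suc x) ∧ f (x ∸ e)
shift-coeff zero f x = refl
shift-coeff (suc e) f zero = refl
shift-coeff (suc e) f (suc x) = shift-coeff e f x

times1+q^ : ℕ → Series → Series
times1+q^ e f = f ⊕ shift e f

times1+q^-cong : ∀ e {f g} → f ≈ g → times1+q^ e f ≈ times1+q^ e g
times1+q^-cong e p = ⊕-cong p (shift-cong e p)

times1+q^-≡ : ∀ {a b} f → a ≡ b → times1+q^ a f ≈ times1+q^ b f
times1+q^-≡ f refl = ≈-refl

times1+q^-comm : ∀ a b f → times1+q^ a (times1+q^ b f) ≈ times1+q^ b (times1+q^ a f)
times1+q^-comm a b f x = begin
  (f x xor shift b f x) xor shift a (f ⊕ shift b f) x
    ≡⟨ cong ((f x xor shift b f x) xor_) (shift-⊕ a f (shift b f) x) ⟩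
  (f x xor shift b f x) xor (shift a f x xor shift a (shift b f) x)
    ≡⟨ cong (λ t → (f x xor shift b f x) xor (shift a f x xor t)) (shift-shift a b b a f (ℕₚ.+-comm a b) x) ⟩
  (f x xor shift b f x) xor (shift a f x xor shift b (shift a f) x)
    ≡⟨ rearrange (f x) (shift b f x) (shift a f x) (shift b (shift a f) x) ⟩
  (f x xor shift a f x) xor (shift b f x xor shift b (shift a f) x)
    ≡⟨ cong ((f x xor shift a f x) xor_) (sym (shift-⊕ b f (shift a f) x)) ⟩
  (f x xor shift a f x) xor shift b (f ⊕ shift a f) x ∎
  where
  rearrange : ∀ u v w z → (u xor v) xor (w xor z) ≡ (u xor w) xor (v xor z)
  rearrange = solve-∀ 𝔽₂

-- Frobenius in characteristic 2: (1 + qᵃ)² = 1 + q²ᵃ.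
times1+q^-square : ∀ a f → times1+q^ a (times1+q^ a f) ≈ times1+q^ (a + a) f
times1+q^-square a f x = begin
  (f x xor shift a f x) xor shift a (f ⊕ shift a f) x
    ≡⟨ cong ((f x xor shift a f x) xor_) (shift-⊕ a f (shift a f) x) ⟩
  (f x xor shift a f x) xor (shift a f x xor shift a (shift a f) x)
    ≡⟨ cancel (f x) (shift a f x) (shift a (shift a f) x) ⟩
  f x xor shift a (shift a f) x
    ≡⟨ cong (f x xor_) (sym (shift-+ a a f x)) ⟩
  f x xor shift (a + a) f x ∎
  where
  cancel : ∀ u v w → (u xor v) xor (v xor w) ≡ u xor w
  cancel = solve-∀ 𝔽₂

times1+q^-high : ∀ N e f x → N < e → x ≤ N → times1+q^ e f x ≡ f x
times1+q^-high N e f x N<e x≤N =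
  trans (cong (f x xor_) (shift-below e f x (ℕₚ.≤-<-trans x≤N N<e))) (Boolₚ.xor-identityʳ (f x))

AgreeUpTo : ℕ → Series → Series → Set
AgreeUpTo N f g = ∀ x → x ≤ N → f x ≡ g x

xor-cancelʳ : ∀ a b s → a xor s ≡ b xor s → a ≡ b
xor-cancelʳ a b s eq = begin
  a               ≡⟨ sym (xor-xor a s) ⟩
  (a xor s) xor s ≡⟨ cong (_xor s) eq ⟩
  (b xor s) xor s ≡⟨ xor-xor b s ⟩
  b               ∎
  where
  xor-xor : ∀ u v → (u xor v) xor v ≡ u
  xor-xor = solve-∀ 𝔽₂

-- 1 + qᵉ (e ≥ 1) is cancellable modulo q^{N+1}: the coefficient of f in
-- degree x is recovered from that of (1 + qᵉ)f and the lower ones of f.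
times1+q^-injective : ∀ N e {f g} →
  AgreeUpTo N (times1+q^ (suc e) f) (times1+q^ (suc e) g) → AgreeUpTo N f g
times1+q^-injective N e {f} {g} p = <-rec (λ x → x ≤ N → f x ≡ g x) step
  where
  step : ∀ x → (∀ {y} → y < x → y ≤ N → f y ≡ g y) → x ≤ N → f x ≡ g x
  step x below x≤N = xor-cancelʳ (f x) (g x) _
    (trans (p x x≤N) (cong (g x xor_) (sym (shift-local (suc e) x lower))))
    where
    lower : ∀ y → y + suc e ≤ x → f y ≡ g y
    lower y le = below y<x (ℕₚ.≤-trans (ℕₚ.<⇒≤ y<x) x≤N)
      where
      y<x : y < x
      y<x = ℕₚ.<-≤-trans (ℕₚ.m<m+n y (s≤s z≤n)) le

prodRange : (ℕ → ℕ) → ℕ → ℕ → Series → Series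
prodRange g k zero f = f
prodRange g k (suc L) f = times1+q^ (g (suc k)) (prodRange g (suc k) L f)

prodRange-top : ∀ g k L f →
  prodRange g k (suc L) f ≈ times1+q^ (g (suc (k + L))) (prodRange g k L f)
prodRange-top g k zero f = times1+q^-≡ f (cong (g ∘ suc) (sym (ℕₚ.+-identityʳ k)))
prodRange-top g k (suc L) f =
  ≈-trans (times1+q^-cong (g (suc k)) (prodRange-top g (suc k) L f))
  (≈-trans (times1+q^-comm (g (suc k)) (g (suc (suc k + L))) (prodRange g (suc k) L f))
           (times1+q^-≡ (prodRange g k (suc L) f) (cong (g ∘ suc) (sym (ℕₚ.+-suc k L)))))

xorSum : (ℕ → Bool) → ℕ → Bool
xorSum h zero = false
xorSum h (suc n) = h 0 xor xorSum (h ∘ suc) n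

xorSum-cong : ∀ n h g → (∀ i → i < n → h i ≡ g i) → xorSum h n ≡ xorSum g n
xorSum-cong zero h g p = refl
xorSum-cong (suc n) h g p =
  cong₂ _xor_ (p 0 (s≤s z≤n)) (xorSum-cong n (h ∘ suc) (g ∘ suc) (λ i i<n → p (suc i) (s≤s i<n)))

xorSum-xor : ∀ n h g → xorSum (λ i → h i xor g i) n ≡ xorSum h n xor xorSum g n
xorSum-xor zero h g = refl
xorSum-xor (suc n) h g =
  trans (cong ((h 0 xor g 0) xor_) (xorSum-xor n (h ∘ suc) (g ∘ suc)))
        (interchange (h 0) (g 0) (xorSum (h ∘ suc) n) (xorSum (g ∘ suc) n))
  where
  interchange : ∀ a b c d → (a xor b) xor (c xor d) ≡ (a xor c) xor (b xor d)
  interchange = solve-∀ 𝔽₂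

xorSum-last : ∀ n h → xorSum h (suc n) ≡ xorSum h n xor h n
xorSum-last zero h = Boolₚ.xor-comm (h 0) false
xorSum-last (suc n) h =
  trans (cong (h 0 xor_) (xorSum-last n (h ∘ suc))) (sym (Boolₚ.xor-assoc (h 0) _ _))

xorSum-zero : ∀ n h → (∀ i → i < n → h i ≡ false) → xorSum h n ≡ false
xorSum-zero n h p = trans (xorSum-cong n h (λ _ → false) p) (zeros n)
  where
  zeros : ∀ n → xorSum (λ _ → false) n ≡ false
  zeros zero = refl
  zeros (suc n) = zeros n

xorSum-extend : ∀ n k h → (∀ i → n ≤ i → h i ≡ false) → xorSum h (n + k) ≡ xorSum h n
xorSum-extend zero k h p = xorSum-zero k h (λ i _ → p i z≤n)
xorSum-extend (suc n) k h p =
  cong (h 0 xor_) (xorSum-extend n k (h ∘ suc) (λ i n≤i → p (suc i) (s≤s n≤i)))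

xorSum-single : ∀ j h N → j < N → xorSum (λ i → (j ≡ᵇ i) ∧ h i) N ≡ h j
xorSum-single zero h (suc N) _ =
  trans (cong (h 0 xor_) (xorSum-zero N _ (λ _ _ → refl))) (Boolₚ.xor-identityʳ (h 0))
xorSum-single (suc j) h (suc N) (s≤s j<N) = xorSum-single j (λ i → h (suc i)) N j<N

seriesSum : (ℕ → Series) → ℕ → Series
seriesSum F n x = xorSum (λ k → F k x) n

seriesSum-cong : ∀ n F G → (∀ k → k < n → F k ≈ G k) → seriesSum F n ≈ seriesSum G n
seriesSum-cong n F G p x = xorSum-cong n (λ k → F k x) (λ k → G k x) (λ k k<n → p k k<n x)

seriesSum-⊕ : ∀ n F G → seriesSum (λ k → F k ⊕ G k) n ≈ seriesSum F n ⊕ seriesSum G n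
seriesSum-⊕ n F G x = xorSum-xor n (λ k → F k x) (λ k → G k x)

seriesSum-last : ∀ n F → seriesSum F (suc n) ≈ seriesSum F n ⊕ F n
seriesSum-last n F x = xorSum-last n (λ k → F k x)

monomial : ℕ → Series
monomial e = shift e one

monomial-self : ∀ e → monomial e e ≡ true
monomial-self zero = refl
monomial-self (suc e) = monomial-self e

monomial-above : ∀ e x → e < x → monomial e x ≡ false
monomial-above zero (suc x) _ = refl
monomial-above (suc e) (suc x) (s≤s e<x) = monomial-above e x e<x

monomial-support : ∀ e x → monomial e x ≡ true → x ≡ e
monomial-support zero zero _ = refl
monomial-support (suc e) (suc x) p = cong suc (monomial-support e x p)

-- Triangular numbers and the generalized pentagonal numbers
-- pentA j = j(3j-1)/2 and pentB j = j(3j+1)/2.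
triangular : ℕ → ℕ
triangular zero = 0
triangular (suc k) = triangular k + suc k

pentA : ℕ → ℕ
pentA zero = 0
pentA (suc m) = suc m * suc m + triangular m

pentB : ℕ → ℕ
pentB j = pentA j + j

-- The truncated pentagonal series Σ_{|j|≤m} q^{j(3j-1)/2} over 𝔽₂.
pentSeries : ℕ → Series
pentSeries zero = one
pentSeries (suc m) = pentSeries m ⊕ monomial (pentA (suc m)) ⊕ monomial (pentB (suc m))

distinctParts : ℕ → Series
distinctParts m = prodRange (λ i → i) 0 m one

-- Shanks' finite form of Euler's identity, read modulo 2:
--   Σ_{k=0}^{m} q^{mk + k(k+1)/2} ∏_{i=k+1}^{m} (1+qⁱ) = Σ_{|j|≤m} q^{j(3j-1)/2}.
shanksExp : ℕ → ℕ → ℕ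
shanksExp m k = m * k + triangular k

shanksTerm : ℕ → ℕ → Series
shanksTerm m k = shift (shanksExp m k) (prodRange (λ i → i) k (m ∸ k) one)

shanksSum : ℕ → Series
shanksSum m = seriesSum (shanksTerm m) (suc m)

prodRange-≡ : ∀ g k {L L′} f → L ≡ L′ → prodRange g k L f ≈ prodRange g k L′ f
prodRange-≡ g k f refl = ≈-refl

prodRange-peel : ∀ g k n f → k ≤ n →
  prodRange g k (suc n ∸ k) f ≈ times1+q^ (g (suc n)) (prodRange g k (n ∸ k) f)
prodRange-peel g k n f k≤n =
  ≈-trans (prodRange-≡ g k f (ℕₚ.+-∸-assoc 1 k≤n))
  (≈-trans (prodRange-top g k (n ∸ k) f)
           (times1+q^-≡ (prodRange g k (n ∸ k) f) (cong (g ∘ suc) (ℕₚ.m+[n∸m]≡n k≤n))))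

shanksTerm-split : ∀ m k → k ≤ m →
  shanksTerm (suc m) k ≈ shift k (shanksTerm m k) ⊕ shift (suc m + k) (shanksTerm m k)
shanksTerm-split m k k≤m =
  ≈-trans (shift-≡ _ (ℕₚ.+-assoc k (m * k) (triangular k)))
  (≈-trans (shift-cong (k + e) (prodRange-peel (λ i → i) k m one k≤m))
  (≈-trans (shift-⊕ (k + e) P (shift (suc m) P))
           (⊕-cong (shift-+ k e P) (shift-shift (k + e) (suc m) (suc m + k) e P (reorder k e m)))))
  where
  e : ℕ
  e = shanksExp m k
  P : Series
  P = prodRange (λ i → i) k (m ∸ k) one
  reorder : ∀ k e m → k + e + suc m ≡ suc m + k + e
  reorder = solve-ℕ

shanksTerm-next : ∀ m k → k < m →
  shift (suc m + k) (shanksTerm m k) ≈ shanksTerm m (suc k) ⊕ shift (suc k) (shanksTerm m (suc k))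
shanksTerm-next m k k<m =
  ≈-trans (≈-sym (shift-+ (suc m + k) (shanksExp m k) P))
  (≈-trans (shift-≡ P (exponent m k (triangular k)))
  (≈-trans (shift-cong e′ (prodRange-≡ (λ i → i) k one (ℕₚ.+-∸-assoc 1 k<m)))
  (≈-trans (shift-⊕ e′ P′ (shift (suc k) P′))
           (⊕-cong (≈-refl {shift e′ P′}) (shift-shift e′ (suc k) (suc k) e′ P′ (ℕₚ.+-comm e′ (suc k)))))))
  where
  P P′ : Series
  P = prodRange (λ i → i) k (m ∸ k) one
  P′ = prodRange (λ i → i) (suc k) (m ∸ suc k) one
  e′ : ℕ
  e′ = shanksExp m (suc k)
  exponent : ∀ m k t → suc m + k + (m * k + t) ≡ m * suc k + (t + suc k)
  exponent = solve-ℕ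

shanksTerm-lastA : ∀ m → shift (suc m + m) (shanksTerm m m) ≈ monomial (pentA (suc m))
shanksTerm-lastA m =
  ≈-trans (shift-cong (suc m + m) (shift-cong (shanksExp m m) (prodRange-≡ (λ i → i) m one (ℕₚ.n∸n≡0 m))))
  (≈-trans (≈-sym (shift-+ (suc m + m) (shanksExp m m) one)) (shift-≡ one (exponent m (triangular m))))
  where
  exponent : ∀ m t → suc m + m + (m * m + t) ≡ suc m * suc m + t
  exponent = solve-ℕ

shanksTerm-lastB : ∀ m → shanksTerm (suc m) (suc m) ≈ monomial (pentB (suc m))
shanksTerm-lastB m =
  ≈-trans (shift-cong (shanksExp (suc m) (suc m)) (prodRange-≡ (λ i → i) (suc m) one (ℕₚ.n∸n≡0 m)))
          (shift-≡ one (exponent m (triangular m)))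
  where
  exponent : ∀ m t → suc m * suc m + (t + suc m) ≡ (suc m * suc m + t) + suc m
  exponent = solve-ℕ

shanksSum-step : ∀ m →
  shanksSum (suc m) ≈ shanksSum m ⊕ monomial (pentA (suc m)) ⊕ monomial (pentB (suc m))
shanksSum-step m x = begin
  shanksSum (suc m) x
    ≡⟨ seriesSum-last (suc m) (shanksTerm (suc m)) x ⟩
  seriesSum (shanksTerm (suc m)) (suc m) x xor shanksTerm (suc m) (suc m) x
    ≡⟨ cong₂ _xor_ (trans (seriesSum-cong (suc m) _ _ split x) (seriesSum-⊕ (suc m) low high x))
                   (shanksTerm-lastB m x) ⟩
  (seriesSum low (suc m) x xor seriesSum high (suc m) x) xor monomial (pentB (suc m)) x
    ≡⟨ cong (λ t → (seriesSum low (suc m) x xor t) xor monomial (pentB (suc m)) x) highSum ⟩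
  ((T 0 x xor X) xor ((Y xor X) xor monomial (pentA (suc m)) x)) xor monomial (pentB (suc m)) x
    ≡⟨ cancel (T 0 x) X Y (monomial (pentA (suc m)) x) (monomial (pentB (suc m)) x) ⟩
  ((T 0 x xor Y) xor monomial (pentA (suc m)) x) xor monomial (pentB (suc m)) x ∎
  where
  T : ℕ → Series
  T = shanksTerm m
  low high : ℕ → Series
  low k = shift k (T k)
  high k = shift (suc m + k) (T k)
  X Y : Bool
  X = seriesSum (λ k → shift (suc k) (T (suc k))) m x
  Y = seriesSum (λ k → T (suc k)) m x
  split : ∀ k → k < suc m → shanksTerm (suc m) k ≈ low k ⊕ high k
  split k (s≤s k≤m) = shanksTerm-split m k k≤m
  highSum : seriesSum high (suc m) x ≡ (Y xor X) xor monomial (pentA (suc m)) x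
  highSum = trans (seriesSum-last m high x)
    (cong₂ _xor_ (trans (seriesSum-cong m high _ (shanksTerm-next m) x)
                        (seriesSum-⊕ m (λ k → T (suc k)) (λ k → shift (suc k) (T (suc k))) x))
                 (shanksTerm-lastA m x))
  cancel : ∀ a x y p q → ((a xor x) xor ((y xor x) xor p)) xor q ≡ ((a xor y) xor p) xor q
  cancel = solve-∀ 𝔽₂

shanks : ∀ m → shanksSum m ≈ pentSeries m
shanks zero x = Boolₚ.xor-identityʳ (one x)
shanks (suc m) = ≈-trans (shanksSum-step m) (⊕-cong (⊕-cong (shanks m) ≈-refl) ≈-refl)

shanksExp-large : ∀ m k → m < shanksExp m (suc k)
shanksExp-large m k =
  ℕₚ.<-≤-trans (ℕₚ.m<m+n m (s≤s z≤n))
               (ℕₚ.+-mono-≤ (ℕₚ.m≤m*n m (suc k)) (ℕₚ.m≤n+m (suc k) (triangular k)))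

shanksSum-truncation : ∀ m → AgreeUpTo m (shanksSum m) (distinctParts m)
shanksSum-truncation m x x≤m = begin
  shanksTerm m 0 x xor xorSum (λ k → shanksTerm m (suc k) x) m
    ≡⟨ cong₂ _xor_ (shift-≡ (distinctParts m) (trans (ℕₚ.+-identityʳ (m * 0)) (ℕₚ.*-zeroʳ m)) x)
                   (xorSum-zero m _ (λ k _ → shift-below _ _ x (ℕₚ.≤-<-trans x≤m (shanksExp-large m k)))) ⟩
  distinctParts m x xor false
    ≡⟨ Boolₚ.xor-identityʳ _ ⟩
  distinctParts m x ∎

pentB<pentA : ∀ m → pentB m < pentA (suc m)
pentB<pentA zero = s≤s z≤n
pentB<pentA (suc m) = subst (suc (pentB (suc m)) ≤_) (sym (gap m (triangular m))) (ℕₚ.m≤m+n _ _)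
  where
  gap : ∀ m t → suc (suc m) * suc (suc m) + (t + suc m) ≡ suc ((suc m * suc m + t) + suc m) + (m + m + 2)
  gap = solve-ℕ

pentA<pentB : ∀ m → pentA (suc m) < pentB (suc m)
pentA<pentB m = subst (_≤ pentB (suc m)) (ℕₚ.+-comm (pentA (suc m)) 1) (ℕₚ.+-monoʳ-≤ (pentA (suc m)) (s≤s z≤n))

pentB-mono : ∀ j m → j ≤ m → pentB j ≤ pentB m
pentB-mono j zero z≤n = ℕₚ.≤-refl
pentB-mono j (suc m) j≤sm with ℕₚ.m≤n⇒m<n∨m≡n j≤sm
... | inj₂ refl = ℕₚ.≤-refl
... | inj₁ (s≤s j≤m) = ℕₚ.≤-trans (pentB-mono j m j≤m) (ℕₚ.<⇒≤ (ℕₚ.<-trans (pentB<pentA m) (pentA<pentB m)))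

IsPentagonal : ℕ → Set
IsPentagonal x = ∃[ j ] (x ≡ pentA j ⊎ x ≡ pentB j)

pentSeries-step-low : ∀ m y → y ≤ pentB m → pentSeries (suc m) y ≡ pentSeries m y
pentSeries-step-low m y y≤ = begin
  (pentSeries m y xor monomial (pentA (suc m)) y) xor monomial (pentB (suc m)) y
    ≡⟨ cong₂ _xor_ (cong (pentSeries m y xor_) (shift-below _ one y y<A))
                   (shift-below _ one y (ℕₚ.<-trans y<A (pentA<pentB m))) ⟩
  (pentSeries m y xor false) xor false
    ≡⟨ trans (Boolₚ.xor-identityʳ _) (Boolₚ.xor-identityʳ _) ⟩
  pentSeries m y ∎
  where
  y<A : y < pentA (suc m)
  y<A = ℕₚ.≤-<-trans y≤ (pentB<pentA m)

pentSeries-high : ∀ m x → pentB m < x → pentSeries m x ≡ false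
pentSeries-high zero (suc x) _ = refl
pentSeries-high (suc m) x lt =
  cong₂ _xor_ (cong₂ _xor_ (pentSeries-high m x (ℕₚ.<-trans (ℕₚ.<-trans (pentB<pentA m) (pentA<pentB m)) lt))
                           (monomial-above _ x (ℕₚ.<-trans (pentA<pentB m) lt)))
              (monomial-above _ x lt)

pentSeries-sound : ∀ m x → pentSeries m x ≡ true → IsPentagonal x
pentSeries-sound zero zero _ = 0 , inj₁ refl
pentSeries-sound (suc m) x p
  with pentSeries m x in old | monomial (pentA (suc m)) x in isA | monomial (pentB (suc m)) x in isB
... | true | _ | _ = pentSeries-sound m x old
... | false | true | _ = suc m , inj₁ (monomial-support _ x isA)
... | false | false | true = suc m , inj₂ (monomial-support _ x isB)
... | false | false | false with p
... | ()

pentSeries-complete : ∀ m j → j ≤ m → pentSeries m (pentA j) ≡ true × pentSeries m (pentB j) ≡ true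
pentSeries-complete zero zero z≤n = refl , refl
pentSeries-complete (suc m) j j≤sm with ℕₚ.m≤n⇒m<n∨m≡n j≤sm
... | inj₁ (s≤s j≤m) =
  trans (pentSeries-step-low m (pentA j) (ℕₚ.≤-trans (ℕₚ.m≤m+n (pentA j) j) (pentB-mono j m j≤m)))
        (proj₁ (pentSeries-complete m j j≤m)) ,
  trans (pentSeries-step-low m (pentB j) (pentB-mono j m j≤m)) (proj₂ (pentSeries-complete m j j≤m))
... | inj₂ refl =
  cong₂ _xor_ (cong₂ _xor_ (pentSeries-high m _ (pentB<pentA m)) (monomial-self (pentA (suc m))))
              (shift-below _ one _ (pentA<pentB m)) ,
  cong₂ _xor_ (cong₂ _xor_ (pentSeries-high m _ (ℕₚ.<-trans (pentB<pentA m) (pentA<pentB m)))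
                           (monomial-above _ _ (pentA<pentB m)))
              (monomial-self (pentB (suc m)))

j≤pentA : ∀ j → j ≤ pentA j
j≤pentA zero = z≤n
j≤pentA (suc j) = ℕₚ.≤-trans (ℕₚ.m≤m*n (suc j) (suc j)) (ℕₚ.m≤m+n _ (triangular j))

distinctParts≡pentSeries : ∀ x → distinctParts x x ≡ pentSeries x x
distinctParts≡pentSeries x = trans (sym (shanksSum-truncation x x ℕₚ.≤-refl)) (shanks x x)

euler-sound : ∀ x → distinctParts x x ≡ true → IsPentagonal x
euler-sound x p = pentSeries-sound x x (trans (sym (distinctParts≡pentSeries x)) p)

euler-complete : ∀ x → IsPentagonal x → distinctParts x x ≡ true
euler-complete x (j , x≡) = trans (distinctParts≡pentSeries x) (at x≡)
  where
  at : x ≡ pentA j ⊎ x ≡ pentB j → pentSeries x x ≡ true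
  at (inj₁ refl) = proj₁ (pentSeries-complete (pentA j) j (j≤pentA j))
  at (inj₂ refl) = proj₂ (pentSeries-complete (pentB j) j (ℕₚ.≤-trans (j≤pentA j) (ℕₚ.m≤m+n (pentA j) j)))

isOdd : ℕ → Bool
isOdd zero = false
isOdd (suc k) = not (isOdd k)

isOdd-double : ∀ h → isOdd (h + h) ≡ false
isOdd-double zero = refl
isOdd-double (suc h) =
  trans (cong isOdd (ℕₚ.+-suc (suc h) h)) (trans (Boolₚ.not-involutive _) (isOdd-double h))

halve : ∀ m → ∃[ h ] (m ≡ h + h ⊎ m ≡ suc (h + h))
halve zero = 0 , inj₁ refl
halve (suc m) with halve m
... | h , inj₁ e = h , inj₂ (cong suc e)
... | h , inj₂ e = suc h , inj₁ (cong suc (trans e (sym (ℕₚ.+-suc h h))))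

oddProduct : ℕ → Series → Series
oddProduct zero f = f
oddProduct (suc m) f = if isOdd (suc m) then oddProduct m (times1+q^ (suc m) f) else oddProduct m f

oddProduct-cong : ∀ m {f g} → f ≈ g → oddProduct m f ≈ oddProduct m g
oddProduct-cong zero p = p
oddProduct-cong (suc m) p with isOdd (suc m)
... | true = oddProduct-cong m (times1+q^-cong (suc m) p)
... | false = oddProduct-cong m p

oddProduct-times : ∀ m e f → oddProduct m (times1+q^ e f) ≈ times1+q^ e (oddProduct m f)
oddProduct-times zero e f = ≈-refl
oddProduct-times (suc m) e f with isOdd (suc m)
... | true = ≈-trans (oddProduct-cong m (times1+q^-comm (suc m) e f)) (oddProduct-times m e (times1+q^ (suc m) f))
... | false = oddProduct-times m e f

oddProduct-injective : ∀ N m f g → AgreeUpTo N (oddProduct m f) (oddProduct m g) → AgreeUpTo N f g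
oddProduct-injective N zero f g p = p
oddProduct-injective N (suc m) f g p with isOdd (suc m)
... | true = times1+q^-injective N m (oddProduct-injective N m _ _ p)
... | false = oddProduct-injective N m f g p

oddDistinct : ℕ → Series
oddDistinct m = oddProduct m (distinctParts m)

-- An odd index contributes (1+qⁱ)² = 1+q²ⁱ, an even one just 1+qⁱ.
oddDistinct-odd : ∀ m → isOdd (suc m) ≡ true →
  oddDistinct (suc m) ≈ times1+q^ (suc m + suc m) (oddDistinct m)
oddDistinct-odd m odd rewrite odd =
  ≈-trans (oddProduct-cong m (times1+q^-cong (suc m) (prodRange-top (λ i → i) 0 m one)))
  (≈-trans (oddProduct-cong m (times1+q^-square (suc m) (distinctParts m)))
           (oddProduct-times m (suc m + suc m) (distinctParts m)))

oddDistinct-even : ∀ m → isOdd (suc m) ≡ false →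
  oddDistinct (suc m) ≈ times1+q^ (suc m) (oddDistinct m)
oddDistinct-even m even rewrite even =
  ≈-trans (oddProduct-cong m (prodRange-top (λ i → i) 0 m one)) (oddProduct-times m (suc m) (distinctParts m))

doubles : ℕ → ℕ → Series
doubles h L = prodRange (λ i → i + i) h L one

-- The product telescopes to ∏_{m/2<i≤m}(1+q²ⁱ): an odd index i adds the
-- new top factor 1+q²ⁱ, and an even index 2j squares the bottom factor
-- 1+q²ʲ into the new top factor 1+q⁴ʲ.
oddDistinct-telescope : ∀ h → oddDistinct (h + h) ≈ doubles h h × oddDistinct (suc (h + h)) ≈ doubles h (suc h)
oddDistinct-telescope zero = ≈-refl , oddDistinct-odd 0 refl
oddDistinct-telescope (suc h) = even , odd
  where
  previous : oddDistinct (suc (h + h)) ≈ doubles h (suc h)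
  previous = proj₂ (oddDistinct-telescope h)
  even′ : oddDistinct (suc (suc (h + h))) ≈ doubles (suc h) (suc h)
  even′ =
    ≈-trans (oddDistinct-even (suc (h + h)) (trans (Boolₚ.not-involutive _) (isOdd-double h)))
    (≈-trans (times1+q^-cong (suc (suc (h + h))) previous)
    (≈-trans (times1+q^-≡ (doubles h (suc h)) (sym (ℕₚ.+-suc (suc h) h)))
    (≈-trans (times1+q^-square (suc h + suc h) (doubles (suc h) h))
    (≈-trans (times1+q^-≡ (doubles (suc h) h) (exponent h))
             (≈-sym (prodRange-top (λ i → i + i) (suc h) h one))))))
    where
    exponent : ∀ h → (suc h + suc h) + (suc h + suc h) ≡ suc (suc h + h) + suc (suc h + h)
    exponent = solve-ℕ
  even : oddDistinct (suc h + suc h) ≈ doubles (suc h) (suc h)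
  even = subst (λ t → oddDistinct t ≈ doubles (suc h) (suc h)) (cong suc (sym (ℕₚ.+-suc h h))) even′
  odd : oddDistinct (suc (suc h + suc h)) ≈ doubles (suc h) (suc (suc h))
  odd =
    ≈-trans (oddDistinct-odd (suc h + suc h) (cong not (isOdd-double (suc h))))
    (≈-trans (times1+q^-cong (suc (suc h + suc h) + suc (suc h + suc h)) even)
             (≈-sym (prodRange-top (λ i → i + i) (suc h) (suc h) one)))

doubles-high : ∀ N h L → N < suc h + suc h → AgreeUpTo N (doubles h L) one
doubles-high N h zero _ x _ = refl
doubles-high N h (suc L) N< x x≤N =
  trans (times1+q^-high N (suc h + suc h) (doubles (suc h) L) x N< x≤N)
        (doubles-high N (suc h) L (ℕₚ.<-trans N< (ℕₚ.+-mono-< (ℕₚ.n<1+n (suc h)) (ℕₚ.n<1+n (suc h)))) x x≤N)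

oddDistinct≡one : ∀ m → AgreeUpTo m (oddDistinct m) one
oddDistinct≡one m with halve m
... | h , inj₁ refl = λ x x≤ → trans (proj₁ (oddDistinct-telescope h) x)
        (doubles-high (h + h) h h (ℕₚ.+-mono-< (ℕₚ.n<1+n h) (ℕₚ.n<1+n h)) x x≤)
... | h , inj₂ refl = λ x x≤ → trans (proj₂ (oddDistinct-telescope h) x)
        (doubles-high (suc (h + h)) h (suc h) (s≤s (ℕₚ.+-monoʳ-< h (ℕₚ.n<1+n h))) x x≤)

xorCount : (List Part → Bool) → List (List Part) → Bool
xorCount P [] = false
xorCount P (l ∷ C) = P l xor xorCount P C

xorCount-++ : ∀ P C D → xorCount P (C ++ D) ≡ xorCount P C xor xorCount P D
xorCount-++ P [] D = refl
xorCount-++ P (l ∷ C) D = trans (cong (P l xor_) (xorCount-++ P C D)) (sym (Boolₚ.xor-assoc (P l) _ _))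

xorCount-applyUpTo : ∀ P (g : ℕ → List (List Part)) (h : ℕ → ℕ) n →
  xorCount P (concatMap g (applyUpTo h n)) ≡ xorSum (λ i → xorCount P (g (h i))) n
xorCount-applyUpTo P g h zero = refl
xorCount-applyUpTo P g h (suc n) =
  trans (xorCount-++ P (g (h 0)) _) (cong (xorCount P (g (h 0)) xor_) (xorCount-applyUpTo P g (h ∘ suc) n))

xorCount-map : ∀ P y C → xorCount P (map (y ∷_) C) ≡ xorCount (λ l → P (y ∷ l)) C
xorCount-map P y [] = refl
xorCount-map P y (l ∷ C) = cong (P (y ∷ l) xor_) (xorCount-map P y C)

xorCount-factor : ∀ P Q c C → (∀ l → P l ≡ c ∧ Q l) → xorCount P C ≡ c ∧ xorCount Q C
xorCount-factor P Q c [] eq = sym (Boolₚ.∧-zeroʳ c)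
xorCount-factor P Q c (l ∷ C) eq =
  trans (cong₂ _xor_ (eq l) (xorCount-factor P Q c C eq)) (sym (Boolₚ.∧-distribˡ-xor c (Q l) (xorCount Q C)))

parity : ℕ → Bool
parity zero = false
parity (suc n) = not (parity n)

parity-filter : ∀ P C → parity (length (filter (λ l → P l Boolₚ.≟ true) C)) ≡ xorCount P C
parity-filter P [] = refl
parity-filter P (l ∷ C) with P l
... | true = cong not (parity-filter P C)
... | false = parity-filter P C

toℕ : Bool → ℕ
toℕ true = 1
toℕ false = 0

%2≡parity : ∀ n → n % 2 ≡ toℕ (parity n)
%2≡parity zero = refl
%2≡parity (suc zero) = refl
%2≡parity (suc (suc n)) =
  trans (cong (_% 2) (ℕₚ.+-comm 2 n)) (trans (DivModₚ.[m+n]%n≡m%n n 2)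
        (trans (%2≡parity n) (cong toℕ (sym (Boolₚ.not-involutive (parity n))))))

xorCount-cands : ∀ P f n → xorCount P (cands (suc f) (suc n)) ≡
  xorSum (λ i → xorCount (λ l → P ((suc i , true) ∷ l)) (cands f (n ∸ i))
            xor xorCount (λ l → P ((suc i , false) ∷ l)) (cands f (n ∸ i))) (suc n)
xorCount-cands P f n =
  trans (xorCount-applyUpTo P (λ i → concatMap (λ b → map ((suc i , b) ∷_) (cands f (n ∸ i))) (true ∷ false ∷ [])) (λ i → i) (suc n))
        (xorSum-cong (suc n) _ _ overline)
  where
  overline : ∀ i → i < suc n →
    xorCount P (concatMap (λ b → map ((suc i , b) ∷_) (cands f (n ∸ i))) (true ∷ false ∷ [])) ≡
    xorCount (λ l → P ((suc i , true) ∷ l)) (cands f (n ∸ i)) xor xorCount (λ l → P ((suc i , false) ∷ l)) (cands f (n ∸ i))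
  overline i _ = let C = cands f (n ∸ i) in begin
    xorCount P (map ((suc i , true) ∷_) C ++ (map ((suc i , false) ∷_) C ++ []))
      ≡⟨ xorCount-++ P (map ((suc i , true) ∷_) C) _ ⟩
    xorCount P (map ((suc i , true) ∷_) C) xor xorCount P (map ((suc i , false) ∷_) C ++ [])
      ≡⟨ cong₂ _xor_ (xorCount-map P (suc i , true) C)
                     (trans (xorCount-++ P (map ((suc i , false) ∷_) C) [])
                            (trans (Boolₚ.xor-identityʳ _) (xorCount-map P (suc i , false) C))) ⟩
    xorCount (λ l → P ((suc i , true) ∷ l)) C xor xorCount (λ l → P ((suc i , false) ∷ l)) C ∎

followsPart : ℕ → List Part → Bool
followsPart a [] = true
followsPart a (y ∷ _) = consecOK (a , false) y

fitsUnder : ℕ → List Part → Bool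
fitsUnder a l = isC62 l ∧ followsPart a l

canFollow : ℕ → ℕ → Bool → Bool
canFollow a k b = consecOK (a , false) (k , b) ∧ partOK (k , b)

sortedOK-cons : ∀ k b l → sortedOK ((k , b) ∷ l) ≡ followsPart k l ∧ sortedOK l
sortedOK-cons k b [] = refl
sortedOK-cons k b (y ∷ l) = refl

fitsUnder-cons : ∀ a k b l → fitsUnder a ((k , b) ∷ l) ≡ canFollow a k b ∧ fitsUnder k l
fitsUnder-cons a k b l =
  trans (cong (λ t → (t ∧ (partOK (k , b) ∧ allPartsOK l)) ∧ consecOK (a , false) (k , b)) (sortedOK-cons k b l))
        (rearrange (followsPart k l) (sortedOK l) (partOK (k , b)) (allPartsOK l) (consecOK (a , false) (k , b)))
  where
  rearrange : ∀ c s p q r → ((c ∧ s) ∧ (p ∧ q)) ∧ r ≡ (r ∧ p) ∧ ((s ∧ q) ∧ c)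
  rearrange = solve-∀ 𝔽₂

<ᵇ-true : ∀ {k a} → k < a → (k <ᵇ a) ≡ true
<ᵇ-true {zero} (s≤s _) = refl
<ᵇ-true {suc k} (s≤s k<a) = <ᵇ-true k<a

fitsUnder-large : ∀ a k b l → k < a → fitsUnder a ((k , b) ∷ l) ≡ isC62 ((k , b) ∷ l)
fitsUnder-large a k b l k<a =
  trans (cong (λ t → isC62 ((k , b) ∷ l) ∧ (t ∨ ((a ≡ᵇ k) ∧ not b))) (<ᵇ-true k<a)) (Boolₚ.∧-identityʳ _)

boundedCount : ℕ → ℕ → ℕ → Bool
boundedCount f x a = xorCount (fitsUnder a) (cands f x)

boundedCount-step : ∀ f n a → boundedCount (suc f) (suc n) a ≡
  xorSum (λ i → (canFollow a (suc i) true xor canFollow a (suc i) false) ∧ boundedCount f (n ∸ i) (suc i)) (suc n)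
boundedCount-step f n a = trans (xorCount-cands (fitsUnder a) f n) (xorSum-cong (suc n) _ _ firstPart)
  where
  firstPart : ∀ i → i < suc n →
    xorCount (λ l → fitsUnder a ((suc i , true) ∷ l)) (cands f (n ∸ i)) xor
    xorCount (λ l → fitsUnder a ((suc i , false) ∷ l)) (cands f (n ∸ i)) ≡
    (canFollow a (suc i) true xor canFollow a (suc i) false) ∧ boundedCount f (n ∸ i) (suc i)
  firstPart i _ =
    trans (cong₂ _xor_ (choice true) (choice false))
          (sym (Boolₚ.∧-distribʳ-xor _ (canFollow a (suc i) true) (canFollow a (suc i) false)))
    where
    choice : ∀ b → xorCount (λ l → fitsUnder a ((suc i , b) ∷ l)) (cands f (n ∸ i)) ≡
                   canFollow a (suc i) b ∧ boundedCount f (n ∸ i) (suc i)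
    choice b = xorCount-factor _ (fitsUnder (suc i)) (canFollow a (suc i) b) (cands f (n ∸ i)) (fitsUnder-cons a (suc i) b)

boundedCount-fuel : ∀ f g x a → x ≤ f → x ≤ g → boundedCount f x a ≡ boundedCount g x a
boundedCount-fuel f g zero a _ _ = refl
boundedCount-fuel (suc f) (suc g) (suc n) a (s≤s n≤f) (s≤s n≤g) =
  trans (boundedCount-step f n a)
  (trans (xorSum-cong (suc n) _ _ (λ i _ → cong ((canFollow a (suc i) true xor canFollow a (suc i) false) ∧_)
            (boundedCount-fuel f g (n ∸ i) (suc i) (ℕₚ.≤-trans (ℕₚ.m∸n≤m n i) n≤f) (ℕₚ.≤-trans (ℕₚ.m∸n≤m n i) n≤g))))
         (sym (boundedCount-step g n a)))

-- restricted a: the parity series of C̄₆,₂-overpartitions whose parts are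
-- at most a, with parts equal to a not overlined.
restricted : ℕ → Series
restricted a x = boundedCount x x a

-- Every C̄₆,₂-overpartition of n fits under the part n + 1.
C62bar-parity : ∀ n → C62bar n % 2 ≡ toℕ (restricted (suc n) n)
C62bar-parity n =
  trans (%2≡parity (length (filter (λ l → isC62 l Boolₚ.≟ true) (cands n n))))
        (cong toℕ (trans (parity-filter isC62 (cands n n)) (unbounded n)))
  where
  unbounded : ∀ n → xorCount isC62 (cands n n) ≡ boundedCount n n (suc n)
  unbounded zero = refl
  unbounded (suc n) =
    trans (xorCount-cands isC62 n n) (sym (trans (xorCount-cands (fitsUnder (suc (suc n))) n n)
      (xorSum-cong (suc n) _ _ (λ i i<sn → cong₂ _xor_
        (above i i<sn true) (above i i<sn false)))))
    where
    above : ∀ i → i < suc n → ∀ b →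
      xorCount (λ l → fitsUnder (suc (suc n)) ((suc i , b) ∷ l)) (cands n (n ∸ i)) ≡
      xorCount (λ l → isC62 ((suc i , b) ∷ l)) (cands n (n ∸ i))
    above i i<sn b = xorCount-factor _ _ true (cands n (n ∸ i)) (λ l → fitsUnder-large _ (suc i) b l (s≤s i<sn))

nonMultiple6 : ℕ → Bool
nonMultiple6 k = not (k % 6 ≡ᵇ 0)

odd-residue : ∀ k → nonMultiple6 k ∧ not ((k % 6 ≡ᵇ 2) ∨ (k % 6 ≡ᵇ 4)) ≡ isOdd k
odd-residue 0 = refl
odd-residue 1 = refl
odd-residue 2 = refl
odd-residue 3 = refl
odd-residue 4 = refl
odd-residue 5 = refl
odd-residue (suc (suc (suc (suc (suc (suc k)))))) =
  trans (cong (λ r → not (r ≡ᵇ 0) ∧ not ((r ≡ᵇ 2) ∨ (r ≡ᵇ 4)))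
              (trans (cong (_% 6) (ℕₚ.+-comm 6 k)) (DivModₚ.[m+n]%n≡m%n k 6)))
        (trans (odd-residue k) (sym (trans (Boolₚ.not-involutive _) (trans (Boolₚ.not-involutive _) (Boolₚ.not-involutive _)))))

<ᵇ-≡ᵇ-exclusive : ∀ k a → (k <ᵇ a) ∧ (a ≡ᵇ k) ≡ false
<ᵇ-≡ᵇ-exclusive zero zero = refl
<ᵇ-≡ᵇ-exclusive zero (suc a) = refl
<ᵇ-≡ᵇ-exclusive (suc k) zero = refl
<ᵇ-≡ᵇ-exclusive (suc k) (suc a) = <ᵇ-≡ᵇ-exclusive k a

-- Summing over the overline b of a part: when overlining is allowed the two
-- choices cancel mod 2, unless the part equals the previous one (where only
-- the plain part is allowed).
overline-sum : ∀ L E N V → L ∧ E ≡ false →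
  ((L ∨ (E ∧ not true)) ∧ (N ∧ (not true ∨ V))) xor ((L ∨ (E ∧ not false)) ∧ (N ∧ (not false ∨ V)))
    ≡ (L ∧ (N ∧ not V)) xor (E ∧ N)
overline-sum false false N V _ = refl
overline-sum false true false V _ = refl
overline-sum false true true V _ = refl
overline-sum true false false V _ = refl
overline-sum true false true false _ = refl
overline-sum true false true true _ = refl

canFollow-sum : ∀ a k →
  canFollow a k true xor canFollow a k false ≡ ((k <ᵇ a) ∧ isOdd k) xor ((a ≡ᵇ k) ∧ nonMultiple6 k)
canFollow-sum a k =
  trans (overline-sum (k <ᵇ a) (a ≡ᵇ k) (nonMultiple6 k) ((k % 6 ≡ᵇ 2) ∨ (k % 6 ≡ᵇ 4)) (<ᵇ-≡ᵇ-exclusive k a))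
        (cong (λ t → ((k <ᵇ a) ∧ t) xor ((a ≡ᵇ k) ∧ nonMultiple6 k)) (odd-residue k))

<ᵇ-false : ∀ {k a} → a ≤ k → (k <ᵇ a) ≡ false
<ᵇ-false {k} {zero} _ = refl
<ᵇ-false {suc k} {suc a} (s≤s a≤k) = <ᵇ-false a≤k

infixr 7 _·_
_·_ : Bool → Series → Series
(c · f) x = c ∧ f x

-- oddPartsUpTo a = 1 + Σ_{i≤a odd} qⁱ · restricted i, the contributions of
-- the overpartitions whose largest part is odd and at most a.
oddPartsUpTo : ℕ → Series
oddPartsUpTo a = one ⊕ seriesSum (λ i → isOdd (suc i) · shift (suc i) (restricted (suc i))) a

-- Splitting restricted (a + 1) by the largest part: an odd part below
-- a + 1 or a repeated part a + 1 (if it is not a multiple of 6).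
restricted-rec : ∀ a →
  restricted (suc a) ≈ oddPartsUpTo a ⊕ nonMultiple6 (suc a) · shift (suc a) (restricted (suc a))
restricted-rec a zero =
  sym (cong₂ _xor_ (cong (true xor_) (xorSum-zero a _ (λ i _ → Boolₚ.∧-zeroʳ (isOdd (suc i)))))
                   (Boolₚ.∧-zeroʳ (nonMultiple6 (suc a))))
restricted-rec a (suc n) = begin
  restricted (suc a) (suc n)
    ≡⟨ boundedCount-step n n (suc a) ⟩
  xorSum (λ i → (canFollow (suc a) (suc i) true xor canFollow (suc a) (suc i) false) ∧ boundedCount n (n ∸ i) (suc i)) (suc n)
    ≡⟨ xorSum-cong (suc n) _ _ firstPart ⟩
  xorSum (λ i → A i xor B i) (suc n)
    ≡⟨ sym (xorSum-extend (suc n) a _ beyond) ⟩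
  xorSum (λ i → A i xor B i) (suc n + a)
    ≡⟨ xorSum-xor (suc n + a) A B ⟩
  xorSum A (suc n + a) xor xorSum B (suc n + a)
    ≡⟨ cong₂ _xor_ oddSmaller (xorSum-single a (λ i → nonMultiple6 (suc i) ∧ G i) (suc n + a) (ℕₚ.m<n+m a (s≤s z≤n))) ⟩
  oddPartsUpTo a (suc n) xor (nonMultiple6 (suc a) ∧ G a) ∎
  where
  G : ℕ → Bool
  G i = shift (suc i) (restricted (suc i)) (suc n)
  A B : ℕ → Bool
  A i = ((i <ᵇ a) ∧ isOdd (suc i)) ∧ G i
  B i = (a ≡ᵇ i) ∧ (nonMultiple6 (suc i) ∧ G i)

  rest : ∀ i → i < suc n → boundedCount n (n ∸ i) (suc i) ≡ G i
  rest i i<sn = trans (boundedCount-fuel n (n ∸ i) (n ∸ i) (suc i) (ℕₚ.m∸n≤m n i) ℕₚ.≤-refl)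
                      (sym (trans (shift-coeff (suc i) (restricted (suc i)) (suc n))
                                  (cong (_∧ restricted (suc i) (n ∸ i)) (<ᵇ-true i<sn))))

  firstPart : ∀ i → i < suc n →
    (canFollow (suc a) (suc i) true xor canFollow (suc a) (suc i) false) ∧ boundedCount n (n ∸ i) (suc i) ≡ A i xor B i
  firstPart i i<sn =
    trans (cong₂ _∧_ (canFollow-sum (suc a) (suc i)) (rest i i<sn))
          (distribute ((i <ᵇ a) ∧ isOdd (suc i)) (a ≡ᵇ i) (nonMultiple6 (suc i)) (G i))
    where
    distribute : ∀ p q r g → (p xor (q ∧ r)) ∧ g ≡ (p ∧ g) xor (q ∧ (r ∧ g))
    distribute = solve-∀ 𝔽₂

  beyond : ∀ i → suc n ≤ i → A i xor B i ≡ false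
  beyond i n<i rewrite shift-below (suc i) (restricted (suc i)) (suc n) (s≤s n<i) =
    cong₂ _xor_ (Boolₚ.∧-zeroʳ ((i <ᵇ a) ∧ isOdd (suc i)))
                (trans (cong ((a ≡ᵇ i) ∧_) (Boolₚ.∧-zeroʳ (nonMultiple6 (suc i)))) (Boolₚ.∧-zeroʳ (a ≡ᵇ i)))

  oddSmaller : xorSum A (suc n + a) ≡ oddPartsUpTo a (suc n)
  oddSmaller = begin
    xorSum A (suc n + a)
      ≡⟨ cong (xorSum A) (ℕₚ.+-comm (suc n) a) ⟩
    xorSum A (a + suc n)
      ≡⟨ xorSum-extend a (suc n) A (λ i a≤i → cong (λ t → (t ∧ isOdd (suc i)) ∧ G i) (<ᵇ-false a≤i)) ⟩
    xorSum A a
      ≡⟨ xorSum-cong a A _ (λ i i<a → cong (λ t → (t ∧ isOdd (suc i)) ∧ G i) (<ᵇ-true i<a)) ⟩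
    oddPartsUpTo a (suc n) ∎

restricted-low : ∀ a x → x ≤ a → restricted (suc a) x ≡ oddPartsUpTo a x
restricted-low a x x≤a =
  trans (restricted-rec a x)
        (trans (cong (λ t → oddPartsUpTo a x xor (nonMultiple6 (suc a) ∧ t)) (shift-below (suc a) _ x (s≤s x≤a)))
               (trans (cong (oddPartsUpTo a x xor_) (Boolₚ.∧-zeroʳ _)) (Boolₚ.xor-identityʳ _)))

oddPartsUpTo-step : ∀ a →
  oddPartsUpTo (suc a) ≈ oddPartsUpTo a ⊕ isOdd (suc a) · shift (suc a) (restricted (suc a))
oddPartsUpTo-step a x =
  trans (cong (one x xor_) (seriesSum-last a (λ i → isOdd (suc i) · shift (suc i) (restricted (suc i))) x))
        (sym (Boolₚ.xor-assoc (one x) _ _))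

odd⇒nonMultiple6 : ∀ k → isOdd k ≡ true → nonMultiple6 k ≡ true
odd⇒nonMultiple6 k odd with nonMultiple6 k in eq
... | true = refl
... | false = trans (sym (cong (_∧ not ((k % 6 ≡ᵇ 2) ∨ (k % 6 ≡ᵇ 4))) eq)) (trans (odd-residue k) odd)

-- For an odd part a + 1: (1 + q^{a+1}) · oddPartsUpTo (a + 1) = oddPartsUpTo a,
-- since both oddPartsUpTo (a + 1) and restricted (a + 1) solve
-- f = oddPartsUpTo a + q^{a+1} f.
oddPartsUpTo-odd : ∀ a → isOdd (suc a) ≡ true →
  times1+q^ (suc a) (oddPartsUpTo (suc a)) ≈ oddPartsUpTo a
oddPartsUpTo-odd a odd x = begin
  times1+q^ (suc a) (oddPartsUpTo (suc a)) x
    ≡⟨ times1+q^-cong (suc a) sameSeries x ⟩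
  restricted (suc a) x xor R x
    ≡⟨ cong (_xor R x) (trans (restricted-rec a x) (cong (λ t → oddPartsUpTo a x xor (t ∧ R x)) (odd⇒nonMultiple6 (suc a) odd))) ⟩
  (oddPartsUpTo a x xor R x) xor R x
    ≡⟨ cancel (oddPartsUpTo a x) (R x) ⟩
  oddPartsUpTo a x ∎
  where
  R : Series
  R = shift (suc a) (restricted (suc a))
  cancel : ∀ u v → (u xor v) xor v ≡ u
  cancel = solve-∀ 𝔽₂
  sameSeries : oddPartsUpTo (suc a) ≈ restricted (suc a)
  sameSeries y =
    trans (oddPartsUpTo-step a y)
    (trans (cong (λ t → oddPartsUpTo a y xor (t ∧ R y)) odd)
           (sym (trans (restricted-rec a y) (cong (λ t → oddPartsUpTo a y xor (t ∧ R y)) (odd⇒nonMultiple6 (suc a) odd)))))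

oddPartsUpTo-even : ∀ a → isOdd (suc a) ≡ false → oddPartsUpTo (suc a) ≈ oddPartsUpTo a
oddPartsUpTo-even a even x =
  trans (oddPartsUpTo-step a x)
        (trans (cong (λ t → oddPartsUpTo a x xor (t ∧ shift (suc a) (restricted (suc a)) x)) even) (Boolₚ.xor-identityʳ _))

oddProduct-oddPartsUpTo : ∀ m → oddProduct m (oddPartsUpTo m) ≈ one
oddProduct-oddPartsUpTo zero x = Boolₚ.xor-identityʳ (one x)
oddProduct-oddPartsUpTo (suc m) with isOdd (suc m) in parity-m
... | true = ≈-trans (oddProduct-cong m (oddPartsUpTo-odd m parity-m)) (oddProduct-oddPartsUpTo m)
... | false = ≈-trans (oddProduct-cong m (oddPartsUpTo-even m parity-m)) (oddProduct-oddPartsUpTo m)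

-- Both series are inverse to ∏_{i≤m odd}(1 + qⁱ) modulo q^{m+1}.
oddPartsUpTo≡distinctParts : ∀ m x → x ≤ m → oddPartsUpTo m x ≡ distinctParts m x
oddPartsUpTo≡distinctParts m =
  oddProduct-injective m m (oddPartsUpTo m) (distinctParts m)
    (λ y y≤m → trans (oddProduct-oddPartsUpTo m y) (sym (oddDistinct≡one m y y≤m)))

C62bar-mod2 : ∀ n → C62bar n % 2 ≡ toℕ (distinctParts n n)
C62bar-mod2 n =
  trans (C62bar-parity n)
        (cong toℕ (trans (restricted-low n n ℕₚ.≤-refl) (oddPartsUpTo≡distinctParts n n ℕₚ.≤-refl)))

triangular-double : ∀ m → triangular m + triangular m ≡ m * suc m
triangular-double zero = refl
triangular-double (suc m) =
  trans (regroup (triangular m) m)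
        (trans (cong (_+ (suc m + suc m)) (triangular-double m)) (next m))
  where
  regroup : ∀ t m → (t + suc m) + (t + suc m) ≡ (t + t) + (suc m + suc m)
  regroup = solve-ℕ
  next : ∀ m → m * suc m + (suc m + suc m) ≡ suc m * suc (suc m)
  next = solve-ℕ

pentA-double : ∀ j → 2 * pentA j + j ≡ 3 * (j * j)
pentA-double zero = refl
pentA-double (suc m) =
  trans (regroup (suc m * suc m) (triangular m) (suc m))
        (trans (cong (λ t → 2 * (suc m * suc m) + t + suc m) (triangular-double m)) (square m))
  where
  regroup : ∀ a t s → 2 * (a + t) + s ≡ 2 * a + (t + t) + s
  regroup = solve-ℕ
  square : ∀ m → 2 * (suc m * suc m) + m * suc m + suc m ≡ 3 * (suc m * suc m)
  square = solve-ℕ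

pentB-double : ∀ j → 2 * pentB j ≡ 3 * (j * j) + j
pentB-double j = trans (regroup (pentA j) j) (cong (_+ j) (pentA-double j))
  where
  regroup : ∀ a j → 2 * (a + j) ≡ 2 * a + j + j
  regroup = solve-ℕ

-- The integer form used in Pentagonal: pentA j is k(3k-1)/2 for k = j and
-- pentB j is k(3k-1)/2 for k = -j.
pentA-ℤ : ∀ j → + 2 ℤ.* + (pentA j) ≡ + j ℤ.* (+ 3 ℤ.* + j ℤ.- + 1)
pentA-ℤ j = trans (subtract (+ 2 ℤ.* + (pentA j)) (+ j)) (trans (cong (ℤ._- + j) cast) (factor (+ j)))
  where
  cast : + 2 ℤ.* + (pentA j) ℤ.+ + j ≡ + 3 ℤ.* (+ j ℤ.* + j)
  cast = begin
    + 2 ℤ.* + (pentA j) ℤ.+ + j ≡⟨ cong (ℤ._+ + j) (sym (ℤₚ.pos-* 2 (pentA j))) ⟩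
    + (2 * pentA j) ℤ.+ + j     ≡⟨ sym (ℤₚ.pos-+ (2 * pentA j) j) ⟩
    + (2 * pentA j + j)         ≡⟨ cong +_ (pentA-double j) ⟩
    + (3 * (j * j))             ≡⟨ ℤₚ.pos-* 3 (j * j) ⟩
    + 3 ℤ.* + (j * j)           ≡⟨ cong (+ 3 ℤ.*_) (ℤₚ.pos-* j j) ⟩
    + 3 ℤ.* (+ j ℤ.* + j)       ∎
  subtract : ∀ A J → A ≡ (A ℤ.+ J) ℤ.- J
  subtract = solve-ℤ
  factor : ∀ J → + 3 ℤ.* (J ℤ.* J) ℤ.- J ≡ J ℤ.* (+ 3 ℤ.* J ℤ.- + 1)
  factor = solve-ℤ

pentB-ℤ : ∀ j → + 2 ℤ.* + (pentB j) ≡ ℤ.- + j ℤ.* (+ 3 ℤ.* ℤ.- + j ℤ.- + 1)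
pentB-ℤ j = trans cast (factor (+ j))
  where
  cast : + 2 ℤ.* + (pentB j) ≡ + 3 ℤ.* (+ j ℤ.* + j) ℤ.+ + j
  cast = begin
    + 2 ℤ.* + (pentB j)          ≡⟨ sym (ℤₚ.pos-* 2 (pentB j)) ⟩
    + (2 * pentB j)              ≡⟨ cong +_ (pentB-double j) ⟩
    + (3 * (j * j) + j)          ≡⟨ ℤₚ.pos-+ (3 * (j * j)) j ⟩
    + (3 * (j * j)) ℤ.+ + j      ≡⟨ cong (ℤ._+ + j) (trans (ℤₚ.pos-* 3 (j * j)) (cong (+ 3 ℤ.*_) (ℤₚ.pos-* j j))) ⟩
    + 3 ℤ.* (+ j ℤ.* + j) ℤ.+ + j ∎
  factor : ∀ J → + 3 ℤ.* (J ℤ.* J) ℤ.+ J ≡ ℤ.- J ℤ.* (+ 3 ℤ.* ℤ.- J ℤ.- + 1)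
  factor = solve-ℤ

2*-injective : ∀ n p → + 2 ℤ.* + n ≡ + 2 ℤ.* + p → n ≡ p
2*-injective n p eq =
  ℕₚ.*-cancelˡ-≡ n p 2 (ℤₚ.+-injective (trans (ℤₚ.pos-* 2 n) (trans eq (sym (ℤₚ.pos-* 2 p)))))

IsPentagonal⇒Pentagonal : ∀ n → IsPentagonal n → Pentagonal n
IsPentagonal⇒Pentagonal n (j , inj₁ refl) = + j , pentA-ℤ j
IsPentagonal⇒Pentagonal n (j , inj₂ refl) = ℤ.- + j , pentB-ℤ j

Pentagonal⇒IsPentagonal : ∀ n → Pentagonal n → IsPentagonal n
Pentagonal⇒IsPentagonal n (+ j , eq) = j , inj₁ (2*-injective n (pentA j) (trans eq (sym (pentA-ℤ j))))
Pentagonal⇒IsPentagonal n (ℤ.-[1+ j ] , eq) = suc j , inj₂ (2*-injective n (pentB (suc j)) (trans eq (sym (pentB-ℤ (suc j)))))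

mainTheorem16 : (n : ℕ) → n ≥ 1 →
    (Pentagonal n → C62bar n % 2 ≡ 1) × (¬ Pentagonal n → C62bar n % 2 ≡ 0)
mainTheorem16 n _ = pentagonal , nonPentagonal
  where
  pentagonal : Pentagonal n → C62bar n % 2 ≡ 1
  pentagonal p = trans (C62bar-mod2 n) (cong toℕ (euler-complete n (Pentagonal⇒IsPentagonal n p)))
  nonPentagonal : ¬ Pentagonal n → C62bar n % 2 ≡ 0
  nonPentagonal ¬p with distinctParts n n in coeff
  ... | true = ⊥-elim (¬p (IsPentagonal⇒Pentagonal n (euler-sound n coeff)))
  ... | false = trans (C62bar-mod2 n) (cong toℕ coeff)
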